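{- For formulae $\alpha_1,\beta_1,\dots,\alpha_n,\beta_n$ of $\mathbf{PDBL}$, the s-hypersequent $\alpha_1\vdash\beta_1\mid\alpha_2\vdash\beta_2\mid\dots\mid\alpha_n\vdash\beta_n$ is provable in $\mathbf{PDBL}$ if and only if $\alpha_i\vdash\beta_i$ is provable in $\mathbf{PDBL}$ for some $i\in\{1,\dots,n\}$.
   Context: The logic PDBL. The language has two disjoint countably infinite sets of variables, object variables $\mathbf{OV}$ ($p,q,\dots$) and property variables $\mathbf{PV}$ ($P,Q,\dots$), constants $\top,\bot$, binary connectives $\sqcap,\sqcup$ and unary connectives $\neg,\lrcorner$; formulae: $\top\mid\bot\mid p\mid P\mid\alpha\sqcup\beta\mid\alpha\sqcap\beta\mid\neg\alpha\mid\lrcorner\alpha$. Abbreviations: $\alpha\vee\beta:=\neg(\neg\alpha\sqcap\neg\beta)$, $\alpha\wedge\beta:=\lrcorner(\lrcorner\alpha\sqcup\lrcorner\beta)$. A sequent is a pair of formulae written $\alpha\vdash\beta$; $\alpha\dashv\vdash\beta$ abbreviates the two sequents $\alpha\vdash\beta$, $\beta\vdash\alpha$. An s-hypersequent is a finite sequence $\alpha_1\vdash\beta_1\mid\dots\mid\alpha_n\vdash\beta_n$ of sequents (its components); $B,C,D,E,F,G,H,X$ range over possibly empty s-hypersequents. Axioms (for all formulae $\alpha,\beta,\gamma$, $p\in\mathbf{OV}$, $P\in\mathbf{PV}$): $\alpha\vdash\alpha$; $\alpha\sqcap\beta\vdash\alpha$; $\alpha\sqcap\beta\vdash\beta$; $\alpha\vdash\alpha\sqcup\beta$;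 $\beta\vdash\alpha\sqcup\beta$; $\alpha\sqcap\beta\vdash(\alpha\sqcap\beta)\sqcap(\alpha\sqcap\beta)$; $(\alpha\sqcup\beta)\sqcup(\alpha\sqcup\beta)\vdash\alpha\sqcup\beta$; $\neg(\alpha\sqcap\alpha)\vdash\neg\alpha$; $\lrcorner\alpha\vdash\lrcorner(\alpha\sqcup\alpha)$; $\alpha\sqcap\neg\alpha\vdash\bot$; $\top\vdash\alpha\sqcup\lrcorner\alpha$; $\neg\neg(\alpha\sqcap\beta)\dashv\vdash\alpha\sqcap\beta$; $\lrcorner\lrcorner(\alpha\sqcup\beta)\dashv\vdash\alpha\sqcup\beta$; $\alpha\sqcap\alpha\vdash\alpha\sqcap(\alpha\sqcup\beta)$; $\alpha\sqcup(\alpha\sqcap\beta)\vdash\alpha\sqcup\alpha$; $\alpha\sqcap\alpha\vdash\alpha\sqcap(\alpha\vee\beta)$; $\alpha\sqcup(\alpha\wedge\beta)\vdash\alpha\sqcup\alpha$; $\alpha\sqcap(\beta\vee\gamma)\dashv\vdash(\alpha\sqcap\beta)\vee(\alpha\sqcap\gamma)$; $\alpha\sqcup(\beta\wedge\gamma)\dashv\vdash(\alpha\sqcup\beta)\wedge(\alpha\sqcup\gamma)$; $\bot\vdash\alpha$; $\alpha\vdash\top$; $\neg\top\vdash\bot$; $\top\vdash\lrcorner\bot$; $\neg\bot\dashv\vdash\top\sqcap\top$; $\lrcorner\top\dashv\vdash\bot\sqcup\bot$; $(\alpha\sqcup\alpha)\sqcap(\alpha\sqcup\alpha)\dashv\vdash(\alpha\sqcap\alpha)\sqcup(\alpha\sqcap\alpha)$;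 $p\sqcap p\dashv\vdash p$; $P\sqcup P\dashv\vdash P$; and (Sp) the s-hypersequent $\alpha\vdash\alpha\sqcap\alpha\mid\alpha\sqcup\alpha\vdash\alpha$. Rules: from $B\mid\alpha\vdash\beta\mid C$ infer each of $B\mid\alpha\sqcap\gamma\vdash\beta\sqcap\gamma\mid C$, $B\mid\gamma\sqcap\alpha\vdash\gamma\sqcap\beta\mid C$, $B\mid\alpha\sqcup\gamma\vdash\beta\sqcup\gamma\mid C$, $B\mid\gamma\sqcup\alpha\vdash\gamma\sqcup\beta\mid C$, $B\mid\neg\beta\vdash\neg\alpha\mid C$, $B\mid\lrcorner\beta\vdash\lrcorner\alpha\mid C$; from $B\mid\alpha\vdash\beta\mid C$ and $D\mid\beta\vdash\gamma\mid E$ infer $B\mid D\mid\alpha\vdash\gamma\mid C\mid E$; from $B\mid\alpha\sqcap\beta\vdash\alpha\sqcap\alpha\mid C$, $D\mid\alpha\sqcap\alpha\vdash\alpha\sqcap\beta\mid E$, $F\mid\alpha\sqcup\beta\vdash\beta\sqcup\beta\mid G$, $H\mid\beta\sqcup\beta\vdash\alpha\sqcup\beta\mid X$ infer $B\mid D\mid F\mid H\mid\alpha\vdash\beta\mid C\mid E\mid G\mid X$; external rules: from $B\mid D\mid D\mid C$ infer $B\mid D\mid C$; from $B\mid D\mid E\mid C$ infer $B\mid E\mid D\mid C$; from $B$ infer $B\mid C$. An s-hypersequent is provable if it is the last member of a finite sequence each member of which is an axiom or follows from earlier members by a rule. -}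

module Defs where

open import Data.Nat using (ℕ)
open import Data.List using (List; []; _∷_; _++_; [_])

-- Formulae of PDBL. Object variables and property variables are two
-- disjoint countably infinite sets, indexed here by ℕ.
infixl 7 _⊓_
infixl 6 _⊔_
data Fm : Set where
  ⊤ᶠ ⊥ᶠ : Fm
  ov : ℕ → Fm
  pv : ℕ → Fm
  _⊔_ _⊓_ : Fm → Fm → Fm
  ¬ᶠ : Fm → Fm
  ⌟ᶠ : Fm → Fm

_∨ᶠ_ : Fm → Fm → Fm
a ∨ᶠ b = ¬ᶠ (¬ᶠ a ⊓ ¬ᶠ b)

_∧ᶠ_ : Fm → Fm → Fm
a ∧ᶠ b = ⌟ᶠ (⌟ᶠ a ⊔ ⌟ᶠ b)

infix 4 _⊢_
record Seq : Set where
  constructor _⊢_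
  field
    lhs rhs : Fm

HSeq : Set
HSeq = List Seq

-- Axioms that are single sequents (⊣⊢ unfolded into two sequents)
data AxS : Seq → Set where
  ax-id     : ∀ a → AxS (a ⊢ a)
  ax-⊓l     : ∀ a b → AxS (a ⊓ b ⊢ a)
  ax-⊓r     : ∀ a b → AxS (a ⊓ b ⊢ b)
  ax-⊔l     : ∀ a b → AxS (a ⊢ a ⊔ b)
  ax-⊔r     : ∀ a b → AxS (b ⊢ a ⊔ b)
  ax-⊓dup   : ∀ a b → AxS (a ⊓ b ⊢ (a ⊓ b) ⊓ (a ⊓ b))
  ax-⊔dup   : ∀ a b → AxS ((a ⊔ b) ⊔ (a ⊔ b) ⊢ a ⊔ b)
  ax-¬⊓     : ∀ a → AxS (¬ᶠ (a ⊓ a) ⊢ ¬ᶠ a)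
  ax-⌟⊔     : ∀ a → AxS (⌟ᶠ a ⊢ ⌟ᶠ (a ⊔ a))
  ax-contr  : ∀ a → AxS (a ⊓ ¬ᶠ a ⊢ ⊥ᶠ)
  ax-excl   : ∀ a → AxS (⊤ᶠ ⊢ a ⊔ ⌟ᶠ a)
  ax-¬¬₁    : ∀ a b → AxS (¬ᶠ (¬ᶠ (a ⊓ b)) ⊢ a ⊓ b)
  ax-¬¬₂    : ∀ a b → AxS (a ⊓ b ⊢ ¬ᶠ (¬ᶠ (a ⊓ b)))
  ax-⌟⌟₁    : ∀ a b → AxS (⌟ᶠ (⌟ᶠ (a ⊔ b)) ⊢ a ⊔ b)
  ax-⌟⌟₂    : ∀ a b → AxS (a ⊔ b ⊢ ⌟ᶠ (⌟ᶠ (a ⊔ b)))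
  ax-abs₁   : ∀ a b → AxS (a ⊓ a ⊢ a ⊓ (a ⊔ b))
  ax-abs₂   : ∀ a b → AxS (a ⊔ (a ⊓ b) ⊢ a ⊔ a)
  ax-abs₃   : ∀ a b → AxS (a ⊓ a ⊢ a ⊓ (a ∨ᶠ b))
  ax-abs₄   : ∀ a b → AxS (a ⊔ (a ∧ᶠ b) ⊢ a ⊔ a)
  ax-dist₁  : ∀ a b c → AxS (a ⊓ (b ∨ᶠ c) ⊢ (a ⊓ b) ∨ᶠ (a ⊓ c))
  ax-dist₂  : ∀ a b c → AxS ((a ⊓ b) ∨ᶠ (a ⊓ c) ⊢ a ⊓ (b ∨ᶠ c))
  ax-dist₃  : ∀ a b c → AxS (a ⊔ (b ∧ᶠ c) ⊢ (a ⊔ b) ∧ᶠ (a ⊔ c))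
  ax-dist₄  : ∀ a b c → AxS ((a ⊔ b) ∧ᶠ (a ⊔ c) ⊢ a ⊔ (b ∧ᶠ c))
  ax-⊥      : ∀ a → AxS (⊥ᶠ ⊢ a)
  ax-⊤      : ∀ a → AxS (a ⊢ ⊤ᶠ)
  ax-¬⊤     : AxS (¬ᶠ ⊤ᶠ ⊢ ⊥ᶠ)
  ax-⌟⊥     : AxS (⊤ᶠ ⊢ ⌟ᶠ ⊥ᶠ)
  ax-¬⊥₁    : AxS (¬ᶠ ⊥ᶠ ⊢ ⊤ᶠ ⊓ ⊤ᶠ)
  ax-¬⊥₂    : AxS (⊤ᶠ ⊓ ⊤ᶠ ⊢ ¬ᶠ ⊥ᶠ)
  ax-⌟⊤₁    : AxS (⌟ᶠ ⊤ᶠ ⊢ ⊥ᶠ ⊔ ⊥ᶠ)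
  ax-⌟⊤₂    : AxS (⊥ᶠ ⊔ ⊥ᶠ ⊢ ⌟ᶠ ⊤ᶠ)
  ax-mix₁   : ∀ a → AxS ((a ⊔ a) ⊓ (a ⊔ a) ⊢ (a ⊓ a) ⊔ (a ⊓ a))
  ax-mix₂   : ∀ a → AxS ((a ⊓ a) ⊔ (a ⊓ a) ⊢ (a ⊔ a) ⊓ (a ⊔ a))
  ax-ov₁    : ∀ p → AxS (ov p ⊓ ov p ⊢ ov p)
  ax-ov₂    : ∀ p → AxS (ov p ⊢ ov p ⊓ ov p)
  ax-pv₁    : ∀ P → AxS (pv P ⊔ pv P ⊢ pv P)
  ax-pv₂    : ∀ P → AxS (pv P ⊢ pv P ⊔ pv P)

data Provable : HSeq → Set where
  axiom : ∀ {s} → AxS s → Provable [ s ]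
  sp    : ∀ a → Provable ((a ⊢ a ⊓ a) ∷ (a ⊔ a ⊢ a) ∷ [])
  ⊓R : ∀ B C {a b} c → Provable (B ++ (a ⊢ b) ∷ C) → Provable (B ++ (a ⊓ c ⊢ b ⊓ c) ∷ C)
  ⊓L : ∀ B C {a b} c → Provable (B ++ (a ⊢ b) ∷ C) → Provable (B ++ (c ⊓ a ⊢ c ⊓ b) ∷ C)
  ⊔R : ∀ B C {a b} c → Provable (B ++ (a ⊢ b) ∷ C) → Provable (B ++ (a ⊔ c ⊢ b ⊔ c) ∷ C)
  ⊔L : ∀ B C {a b} c → Provable (B ++ (a ⊢ b) ∷ C) → Provable (B ++ (c ⊔ a ⊢ c ⊔ b) ∷ C)
  ¬R : ∀ B C {a b} → Provable (B ++ (a ⊢ b) ∷ C) → Provable (B ++ (¬ᶠ b ⊢ ¬ᶠ a) ∷ C)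
  ⌟R : ∀ B C {a b} → Provable (B ++ (a ⊢ b) ∷ C) → Provable (B ++ (⌟ᶠ b ⊢ ⌟ᶠ a) ∷ C)
  cut : ∀ B C D E {a b c} →
        Provable (B ++ (a ⊢ b) ∷ C) → Provable (D ++ (b ⊢ c) ∷ E) →
        Provable (B ++ D ++ (a ⊢ c) ∷ C ++ E)
  split : ∀ B C D E F G H X {a b} →
        Provable (B ++ (a ⊓ b ⊢ a ⊓ a) ∷ C) →
        Provable (D ++ (a ⊓ a ⊢ a ⊓ b) ∷ E) →
        Provable (F ++ (a ⊔ b ⊢ b ⊔ b) ∷ G) →
        Provable (H ++ (b ⊔ b ⊢ a ⊔ b) ∷ X) →
        Provable (B ++ D ++ F ++ H ++ (a ⊢ b) ∷ C ++ E ++ G ++ X)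
  ext-contr : ∀ B D C → Provable (B ++ D ++ D ++ C) → Provable (B ++ D ++ C)
  ext-exch  : ∀ B D E C → Provable (B ++ D ++ E ++ C) → Provable (B ++ E ++ D ++ C)
  ext-weak  : ∀ B C → Provable B → Provable (B ++ C)

-- Only the axiom Sp has more than one component, and for every formula α one
-- of its two components is provable on its own: α ⊢ α ⊓ α when α is ⊥, an
-- object variable, a ⊓- or a ¬-formula, and α ⊔ α ⊢ α when α is ⊤, a property
-- variable, a ⊔- or a ⌟-formula.  The internal rules act on one component of
-- each premise: if a premise has a provable side component it survives into
-- the conclusion, and otherwise the rule applies to the provable active
-- sequents alone.  So by induction on derivations some component of a
-- provable s-hypersequent is provable; conversely a provable component
-- extends to the whole s-hypersequent by external weakening and exchange.
module Submission where

open import Defs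
open import Data.List using (List; [_]; []; _∷_; _++_)
open import Data.List.Properties using (++-identityʳ)
open import Data.List.Relation.Unary.Any using (Any; here; there)
open import Data.List.Relation.Unary.Any.Properties using (++⁺ˡ; ++⁺ʳ; ++⁻)
open import Data.List.Relation.Binary.Permutation.Propositional.Properties
  using (Any-resp-↭; shifts)
  renaming (++⁺ˡ to ↭-++⁺ˡ)
open import Data.Product using (_×_; _,_)
open import Data.Sum using (_⊎_; inj₁; inj₂; [_,_]′; map₂)
open import Function using (_∘_; id)
open import Relation.Binary.PropositionalEquality using (subst)

Provable₁ : Seq → Set
Provable₁ s = Provable [ s ]

module ⊢-Reasoning where

  infix  1 begin_
  infixr 2 step-⊢
  infix  3 _∎

  begin_ : ∀ {a b} → Provable₁ (a ⊢ b) → Provable₁ (a ⊢ b)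
  begin_ = id

  step-⊢ : ∀ a {b c} → Provable₁ (b ⊢ c) → Provable₁ (a ⊢ b) → Provable₁ (a ⊢ c)
  step-⊢ a q p = cut [] [] [] [] p q

  syntax step-⊢ a q p = a ⊢⟨ p ⟩ q

  _∎ : ∀ a → Provable₁ (a ⊢ a)
  a ∎ = axiom (ax-id a)

open ⊢-Reasoning

¬α⊢¬α⊓¬α : ∀ a → Provable₁ (¬ᶠ a ⊢ ¬ᶠ a ⊓ ¬ᶠ a)
¬α⊢¬α⊓¬α a = begin
  ¬ᶠ a                        ⊢⟨ ¬R [] [] (axiom (ax-⊓l a a)) ⟩
  z                           ⊢⟨ ¬R [] [] (axiom (ax-¬¬₁ a a)) ⟩
  ¬ᶠ (¬ᶠ z)                   ⊢⟨ ¬R [] [] (axiom (ax-¬⊓ z)) ⟩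
  ¬ᶠ (¬ᶠ (z ⊓ z))             ⊢⟨ axiom (ax-¬¬₁ z z) ⟩
  z ⊓ z                       ⊢⟨ ⊓R [] [] z (axiom (ax-¬⊓ a)) ⟩
  ¬ᶠ a ⊓ z                    ⊢⟨ ⊓L [] [] (¬ᶠ a) (axiom (ax-¬⊓ a)) ⟩
  ¬ᶠ a ⊓ ¬ᶠ a                 ∎
  where
  z = ¬ᶠ (a ⊓ a)

⌟α⊔⌟α⊢⌟α : ∀ a → Provable₁ (⌟ᶠ a ⊔ ⌟ᶠ a ⊢ ⌟ᶠ a)
⌟α⊔⌟α⊢⌟α a = begin
  ⌟ᶠ a ⊔ ⌟ᶠ a                 ⊢⟨ ⊔L [] [] (⌟ᶠ a) (axiom (ax-⌟⊔ a)) ⟩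
  ⌟ᶠ a ⊔ w                    ⊢⟨ ⊔R [] [] w (axiom (ax-⌟⊔ a)) ⟩
  w ⊔ w                       ⊢⟨ axiom (ax-⌟⌟₂ w w) ⟩
  ⌟ᶠ (⌟ᶠ (w ⊔ w))             ⊢⟨ ⌟R [] [] (axiom (ax-⌟⊔ w)) ⟩
  ⌟ᶠ (⌟ᶠ w)                   ⊢⟨ ⌟R [] [] (axiom (ax-⌟⌟₂ a a)) ⟩
  w                           ⊢⟨ ⌟R [] [] (axiom (ax-⊔l a a)) ⟩
  ⌟ᶠ a                        ∎
  where
  w = ⌟ᶠ (a ⊔ a)

α⊢α⊓α⊎α⊔α⊢α : ∀ a → Provable₁ (a ⊢ a ⊓ a) ⊎ Provable₁ (a ⊔ a ⊢ a)
α⊢α⊓α⊎α⊔α⊢α ⊤ᶠ      = inj₂ (axiom (ax-⊤ _))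
α⊢α⊓α⊎α⊔α⊢α ⊥ᶠ      = inj₁ (axiom (ax-⊥ _))
α⊢α⊓α⊎α⊔α⊢α (ov p)  = inj₁ (axiom (ax-ov₂ p))
α⊢α⊓α⊎α⊔α⊢α (pv P)  = inj₂ (axiom (ax-pv₁ P))
α⊢α⊓α⊎α⊔α⊢α (a ⊔ b) = inj₂ (axiom (ax-⊔dup a b))
α⊢α⊓α⊎α⊔α⊢α (a ⊓ b) = inj₁ (axiom (ax-⊓dup a b))
α⊢α⊓α⊎α⊔α⊢α (¬ᶠ a)  = inj₁ (¬α⊢¬α⊓¬α a)
α⊢α⊓α⊎α⊔α⊢α (⌟ᶠ a)  = inj₂ (⌟α⊔⌟α⊢⌟α a)

module _ {A : Set} {P : A → Set} where

  Any-++⁺ʳ-map : ∀ B {xs ys} → (Any P xs → Any P ys) → Any P (B ++ xs) → Any P (B ++ ys)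
  Any-++⁺ʳ-map B f = [ ++⁺ˡ , ++⁺ʳ B ∘ f ]′ ∘ ++⁻ B

  Any-++-∷-map : ∀ B {C s t} → (P s → P t) → Any P (B ++ s ∷ C) → Any P (B ++ t ∷ C)
  Any-++-∷-map B f = Any-++⁺ʳ-map B λ where
    (here p)  → here (f p)
    (there q) → there q

  Any-++-∷⁻ : ∀ B {C s} → Any P (B ++ s ∷ C) → P s ⊎ Any P (B ++ C)
  Any-++-∷⁻ []      (here p)  = inj₁ p
  Any-++-∷⁻ []      (there q) = inj₂ q
  Any-++-∷⁻ (x ∷ B) (here p)  = inj₂ (here p)
  Any-++-∷⁻ (x ∷ B) (there q) = map₂ there (Any-++-∷⁻ B q)

  Any-++-contract : ∀ B D {C} → Any P (B ++ D ++ D ++ C) → Any P (B ++ D ++ C)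
  Any-++-contract B D = Any-++⁺ʳ-map B ([ ++⁺ˡ , id ]′ ∘ ++⁻ D)

  Any-++-split : ∀ B {C ys} → (Any P B → Any P ys) → (Any P C → Any P ys) →
                 Any P (B ++ C) → Any P ys
  Any-++-split B f g = [ f , g ]′ ∘ ++⁻ B

SomeProvable : HSeq → Set
SomeProvable = Any Provable₁

cut-conclusion : ∀ B C D E {a b c} →
  Provable₁ (a ⊢ b) ⊎ SomeProvable (B ++ C) →
  Provable₁ (b ⊢ c) ⊎ SomeProvable (D ++ E) →
  SomeProvable (B ++ D ++ (a ⊢ c) ∷ C ++ E)
cut-conclusion B C D E (inj₁ ab) (inj₁ bc) =
  ++⁺ʳ B (++⁺ʳ D (here (cut [] [] [] [] ab bc)))
cut-conclusion B C D E (inj₂ side) _ =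
  Any-++-split B ++⁺ˡ (++⁺ʳ B ∘ ++⁺ʳ D ∘ there ∘ ++⁺ˡ) side
cut-conclusion B C D E (inj₁ _) (inj₂ side) =
  Any-++-split D (++⁺ʳ B ∘ ++⁺ˡ) (++⁺ʳ B ∘ ++⁺ʳ D ∘ there ∘ ++⁺ʳ C) side

module _ (B C D E F G H X : HSeq) {a b : Fm} where

  private
    after-principal : SomeProvable (C ++ E ++ G ++ X) →
                      SomeProvable (B ++ D ++ F ++ H ++ (a ⊢ b) ∷ C ++ E ++ G ++ X)
    after-principal = ++⁺ʳ B ∘ ++⁺ʳ D ∘ ++⁺ʳ F ∘ ++⁺ʳ H ∘ there

  split-conclusion :
    Provable₁ (a ⊓ b ⊢ a ⊓ a) ⊎ SomeProvable (B ++ C) →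
    Provable₁ (a ⊓ a ⊢ a ⊓ b) ⊎ SomeProvable (D ++ E) →
    Provable₁ (a ⊔ b ⊢ b ⊔ b) ⊎ SomeProvable (F ++ G) →
    Provable₁ (b ⊔ b ⊢ a ⊔ b) ⊎ SomeProvable (H ++ X) →
    SomeProvable (B ++ D ++ F ++ H ++ (a ⊢ b) ∷ C ++ E ++ G ++ X)
  split-conclusion (inj₁ p₁) (inj₁ p₂) (inj₁ p₃) (inj₁ p₄) =
    ++⁺ʳ B (++⁺ʳ D (++⁺ʳ F (++⁺ʳ H (here (split [] [] [] [] [] [] [] [] p₁ p₂ p₃ p₄)))))
  split-conclusion (inj₂ side) _ _ _ =
    Any-++-split B ++⁺ˡ (after-principal ∘ ++⁺ˡ) side
  split-conclusion (inj₁ _) (inj₂ side) _ _ =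
    Any-++-split D (++⁺ʳ B ∘ ++⁺ˡ) (after-principal ∘ ++⁺ʳ C ∘ ++⁺ˡ) side
  split-conclusion (inj₁ _) (inj₁ _) (inj₂ side) _ =
    Any-++-split F (++⁺ʳ B ∘ ++⁺ʳ D ∘ ++⁺ˡ)
                   (after-principal ∘ ++⁺ʳ C ∘ ++⁺ʳ E ∘ ++⁺ˡ) side
  split-conclusion (inj₁ _) (inj₁ _) (inj₁ _) (inj₂ side) =
    Any-++-split H (++⁺ʳ B ∘ ++⁺ʳ D ∘ ++⁺ʳ F ∘ ++⁺ˡ)
                   (after-principal ∘ ++⁺ʳ C ∘ ++⁺ʳ E ∘ ++⁺ʳ G) side

Provable⇒SomeProvable : ∀ {hs} → Provable hs → SomeProvable hs
Provable⇒SomeProvable (axiom ax) = here (axiom ax)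
Provable⇒SomeProvable (sp a) = [ here , there ∘ here ]′ (α⊢α⊓α⊎α⊔α⊢α a)
Provable⇒SomeProvable (⊓R B C c p) = Any-++-∷-map B (⊓R [] [] c) (Provable⇒SomeProvable p)
Provable⇒SomeProvable (⊓L B C c p) = Any-++-∷-map B (⊓L [] [] c) (Provable⇒SomeProvable p)
Provable⇒SomeProvable (⊔R B C c p) = Any-++-∷-map B (⊔R [] [] c) (Provable⇒SomeProvable p)
Provable⇒SomeProvable (⊔L B C c p) = Any-++-∷-map B (⊔L [] [] c) (Provable⇒SomeProvable p)
Provable⇒SomeProvable (¬R B C p) = Any-++-∷-map B (¬R [] []) (Provable⇒SomeProvable p)
Provable⇒SomeProvable (⌟R B C p) = Any-++-∷-map B (⌟R [] []) (Provable⇒SomeProvable p)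
Provable⇒SomeProvable (cut B C D E p q) =
  cut-conclusion B C D E
    (Any-++-∷⁻ B (Provable⇒SomeProvable p)) (Any-++-∷⁻ D (Provable⇒SomeProvable q))
Provable⇒SomeProvable (split B C D E F G H X p₁ p₂ p₃ p₄) =
  split-conclusion B C D E F G H X
    (Any-++-∷⁻ B (Provable⇒SomeProvable p₁)) (Any-++-∷⁻ D (Provable⇒SomeProvable p₂))
    (Any-++-∷⁻ F (Provable⇒SomeProvable p₃)) (Any-++-∷⁻ H (Provable⇒SomeProvable p₄))
Provable⇒SomeProvable (ext-contr B D C p) = Any-++-contract B D (Provable⇒SomeProvable p)
Provable⇒SomeProvable (ext-exch B D E C p) =
  Any-resp-↭ (↭-++⁺ˡ B (shifts D E)) (Provable⇒SomeProvable p)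
Provable⇒SomeProvable (ext-weak B C p) = ++⁺ˡ (Provable⇒SomeProvable p)

Provable-weaken-∷ : ∀ s {hs} → Provable hs → Provable (s ∷ hs)
Provable-weaken-∷ s {hs} p =
  subst Provable (++-identityʳ (s ∷ hs)) (ext-exch [] hs [ s ] [] (ext-weak hs [ s ] p))

SomeProvable⇒Provable : ∀ {hs} → SomeProvable hs → Provable hs
SomeProvable⇒Provable {s ∷ hs} (here p)  = ext-weak [ s ] hs p
SomeProvable⇒Provable {s ∷ hs} (there q) = Provable-weaken-∷ s (SomeProvable⇒Provable q)

proposition40 : (hs : List Seq) →
    (Provable hs → Any (λ s → Provable [ s ]) hs) × (Any (λ s → Provable [ s ]) hs → Provable hs)
proposition40 hs = Provable⇒SomeProvable , SomeProvable⇒Provable
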